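{- Let $(\mathcal{M},d)$ be a Ptolemaic metric space and let $A,B,C\in\mathcal{M}$ satisfy $d(B,C)\ge\max\{d(A,B),d(A,C)\}$. Then for any $O\in\mathcal{M}$, $d(O,A)\le d(O,B)+d(O,C)$.
   Context: A metric space $(\mathcal{M},d)$ is Ptolemaic if for all $A,B,C,D\in\mathcal{M}$, $d(A,C)d(B,D)\le d(A,B)d(C,D)+d(B,C)d(A,D)$. -}

module Defs where

open import Level using (Level; _⊔_; suc)
open import Algebra.Bundles using (CommutativeRing)
open import Relation.Binary.Core using (Rel)
open import Relation.Binary.Structures using (IsTotalOrder)
open import Relation.Binary.PropositionalEquality using (_≡_)
open import Relation.Nullary using (¬_)
open import Data.Product using (∃)
open import Function.Metric.Structures using (IsGeneralMetric)

-- The real numbers ℝ are an instance; the stdlib has no reals.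
record OrderedField (c ℓ₁ ℓ₂ : Level) : Set (suc (c ⊔ ℓ₁ ⊔ ℓ₂)) where
  field
    commutativeRing : CommutativeRing c ℓ₁
  open CommutativeRing commutativeRing public
  field
    _≤_          : Rel Carrier ℓ₂
    isTotalOrder : IsTotalOrder _≈_ _≤_
    1≉0          : ¬ (1# ≈ 0#)
    inverse      : ∀ x → ¬ (x ≈ 0#) → ∃ λ y → x * y ≈ 1#
    +-monoˡ-≤    : ∀ {x y} z → x ≤ y → (x + z) ≤ (y + z)
    *-nonneg     : ∀ {x y} → 0# ≤ x → 0# ≤ y → 0# ≤ (x * y)

IsMetric : ∀ {c ℓ₁ ℓ₂ m} (F : OrderedField c ℓ₁ ℓ₂) {M : Set m}
           → (M → M → OrderedField.Carrier F) → Set _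
IsMetric F {M} d =
  IsGeneralMetric {A = M} _≡_ _≈_ _≤_ 0# _+_ d
  where open OrderedField F

Ptolemaic : ∀ {c ℓ₁ ℓ₂ m} (F : OrderedField c ℓ₁ ℓ₂) {M : Set m}
            → (M → M → OrderedField.Carrier F) → Set _
Ptolemaic F {M} d =
  ∀ A B C D → (d A C * d B D) ≤ ((d A B * d C D) + (d B C * d A D))
  where open OrderedField F

-- Ptolemy's inequality for the quadruple O, B, A, C, together with
-- d(A,C) ≤ d(B,C) and d(A,B) ≤ d(B,C), gives
--   d(O,A) d(B,C) ≤ d(O,B) d(A,C) + d(A,B) d(O,C) ≤ (d(O,B) + d(O,C)) d(B,C),
-- and d(B,C) can be cancelled unless it is 0, in which case A = B = C.
module Submission where

open import Defs
open import Data.Sum using (_⊎_; inj₁; inj₂)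
open import Data.Product using (_,_)
open import Function using (case_of_)
open import Relation.Nullary using (¬_; Dec; yes; no)
open import Relation.Binary.Core using (Rel)
open import Relation.Binary.Bundles using (Poset)
open import Relation.Binary.Structures using (IsTotalOrder)
open import Relation.Binary.Definitions using (Total)
open import Relation.Binary.PropositionalEquality as ≡ using (_≡_; _≢_; refl)
open import Function.Metric.Structures using (IsGeneralMetric)

-- Without decidable equality, x ≢ y is obtained by comparing the outcomes
-- of total x y and total y x: they would agree if x and y were equal.
total⇒≤⊎≢ : ∀ {a ℓ} {A : Set a} {_≤_ : Rel A ℓ} → Total _≤_ →
            ∀ x y → x ≤ y ⊎ x ≢ y
total⇒≤⊎≢ total x y with total x y in eq₁ | total y x in eq₂
... | inj₁ x≤y | _        = inj₁ x≤y
... | inj₂ _   | inj₂ x≤y = inj₁ x≤y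
... | inj₂ _   | inj₁ _   = inj₂ λ { refl → case ≡.trans (≡.sym eq₁) eq₂ of λ () }

module OrderedFieldProperties {c ℓ₁ ℓ₂} (F : OrderedField c ℓ₁ ℓ₂) where
  open OrderedField F
  open IsTotalOrder isTotalOrder public
    using (total; antisym; ≲-respˡ-≈; ≲-respʳ-≈)
    renaming (trans to ≤-trans; reflexive to ≤-reflexive)

  poset : Poset c ℓ₁ ℓ₂
  poset = record { isPartialOrder = IsTotalOrder.isPartialOrder isTotalOrder }

  +-monoʳ-≤ : ∀ {x y} z → x ≤ y → (z + x) ≤ (z + y)
  +-monoʳ-≤ {x} {y} z x≤y =
    ≲-respʳ-≈ (+-comm y z) (≲-respˡ-≈ (+-comm x z) (+-monoˡ-≤ z x≤y))

  +-mono-≤ : ∀ {x y u v} → x ≤ y → u ≤ v → (x + u) ≤ (y + v)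
  +-mono-≤ {y = y} {u = u} x≤y u≤v = ≤-trans (+-monoˡ-≤ u x≤y) (+-monoʳ-≤ y u≤v)

  x≤x+y : ∀ x {y} → 0# ≤ y → x ≤ (x + y)
  x≤x+y x 0≤y = ≲-respˡ-≈ (+-identityʳ x) (+-monoʳ-≤ x 0≤y)

  *-monoʳ-≤ : ∀ {x y z} → 0# ≤ z → x ≤ y → (x * z) ≤ (y * z)
  *-monoʳ-≤ {x} {y} {z} 0≤z x≤y =
    ≲-respʳ-≈ [y-x]z+xz≈yz (≲-respˡ-≈ (+-identityˡ (x * z))
      (+-monoˡ-≤ (x * z) (*-nonneg 0≤y-x 0≤z)))
    where
    open import Relation.Binary.Reasoning.Setoid setoid
    0≤y-x : 0# ≤ (y - x)
    0≤y-x = ≲-respˡ-≈ (-‿inverseʳ x) (+-monoˡ-≤ (- x) x≤y)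
    [y-x]z+xz≈yz : (y - x) * z + x * z ≈ y * z
    [y-x]z+xz≈yz = begin
      (y - x) * z + x * z      ≈⟨ sym (distribʳ z (y - x) x) ⟩
      ((y - x) + x) * z        ≈⟨ *-congʳ (+-assoc y (- x) x) ⟩
      (y + (- x + x)) * z      ≈⟨ *-congʳ (+-congˡ (-‿inverseˡ x)) ⟩
      (y + 0#) * z             ≈⟨ *-congʳ (+-identityʳ y) ⟩
      y * z                    ∎

  *-monoˡ-≤ : ∀ {x y z} → 0# ≤ z → x ≤ y → (z * x) ≤ (z * y)
  *-monoˡ-≤ 0≤z x≤y = ≲-respʳ-≈ (*-comm _ _) (≲-respˡ-≈ (*-comm _ _) (*-monoʳ-≤ 0≤z x≤y))

  *-cancelʳ-≤ : ∀ {x y z} → 0# ≤ z → ¬ (z ≈ 0#) → (x * z) ≤ (y * z) → x ≤ y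
  *-cancelʳ-≤ {x} {y} {z} 0≤z z≉0 xz≤yz with total x y | inverse z z≉0
  ... | inj₁ x≤y | _            = x≤y
  ... | inj₂ y≤x | z⁻¹ , zz⁻¹≈1 = ≤-reflexive (begin
      x                ≈⟨ sym (*-identityʳ x) ⟩
      x * 1#           ≈⟨ *-congˡ (sym zz⁻¹≈1) ⟩
      x * (z * z⁻¹)    ≈⟨ sym (*-assoc x z z⁻¹) ⟩
      (x * z) * z⁻¹    ≈⟨ *-congʳ (antisym xz≤yz (*-monoʳ-≤ 0≤z y≤x)) ⟩
      (y * z) * z⁻¹    ≈⟨ *-assoc y z z⁻¹ ⟩
      y * (z * z⁻¹)    ≈⟨ *-congˡ zz⁻¹≈1 ⟩
      y * 1#           ≈⟨ *-identityʳ y ⟩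
      y                ∎)
    where open import Relation.Binary.Reasoning.Setoid setoid

module MetricProperties {c ℓ₁ ℓ₂ m} (F : OrderedField c ℓ₁ ℓ₂) {M : Set m}
                        {d : M → M → OrderedField.Carrier F} (isMetric : IsMetric F d) where
  open OrderedField F
  open OrderedFieldProperties F
  open IsGeneralMetric isMetric using (nonNegative; ≈⇒0; 0⇒≈) renaming (sym to d-sym)

  d≈0? : ∀ x y → Dec (d x y ≈ 0#)
  d≈0? x y with total⇒≤⊎≢ total (d x y) (d x x)
  ... | inj₁ dxy≤dxx = yes (antisym (≲-respʳ-≈ (≈⇒0 ≡.refl) dxy≤dxx) nonNegative)
  ... | inj₂ dxy≢dxx = no λ dxy≈0 → dxy≢dxx (≡.cong (d x) (≡.sym (0⇒≈ dxy≈0)))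

  module _ (ptolemaic : Ptolemaic F d) {A B C : M}
           (AB≤BC : d A B ≤ d B C) (AC≤BC : d A C ≤ d B C) where

    ptolemy-scaled : ∀ O → (d O A * d B C) ≤ ((d O B + d O C) * d B C)
    ptolemy-scaled O = begin
      d O A * d B C                   ≤⟨ ptolemaic O B A C ⟩
      d O B * d A C + d B A * d O C   ≤⟨ +-mono-≤ (*-monoˡ-≤ nonNegative AC≤BC)
                                                  (*-monoʳ-≤ nonNegative BA≤BC) ⟩
      d O B * d B C + d B C * d O C   ≈⟨ +-congˡ (*-comm (d B C) (d O C)) ⟩
      d O B * d B C + d O C * d B C   ≈⟨ sym (distribʳ (d B C) (d O B) (d O C)) ⟩
      (d O B + d O C) * d B C         ∎
      where
      open import Relation.Binary.Reasoning.PartialOrder poset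
      BA≤BC : d B A ≤ d B C
      BA≤BC = ≲-respˡ-≈ (d-sym A B) AB≤BC

    dBC≈0⇒A≡B : d B C ≈ 0# → A ≡ B
    dBC≈0⇒A≡B dBC≈0 = 0⇒≈ (antisym (≲-respʳ-≈ dBC≈0 AB≤BC) nonNegative)

lemma1 : ∀ {c ℓ₁ ℓ₂ m} (F : OrderedField c ℓ₁ ℓ₂) (M : Set m)
           (d : M → M → OrderedField.Carrier F)
         → IsMetric F d → Ptolemaic F d
         → ∀ A B C
         → OrderedField._≤_ F (d A B) (d B C)
         → OrderedField._≤_ F (d A C) (d B C)
         → ∀ O → OrderedField._≤_ F (d O A) (OrderedField._+_ F (d O B) (d O C))
lemma1 F M d isMetric ptolemaic A B C AB≤BC AC≤BC O = case d≈0? B C of λ where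
    (no dBC≉0)  → *-cancelʳ-≤ nonNegative dBC≉0 (ptolemy-scaled ptolemaic AB≤BC AC≤BC O)
    (yes dBC≈0) → ≡.subst (λ X → d O X ≤ (d O B + d O C))
                          (≡.sym (dBC≈0⇒A≡B ptolemaic AB≤BC AC≤BC dBC≈0))
                          (x≤x+y (d O B) nonNegative)
  where
  open OrderedField F using (_≤_; _+_)
  open OrderedFieldProperties F using (*-cancelʳ-≤; x≤x+y)
  open IsGeneralMetric isMetric using (nonNegative)
  open MetricProperties F isMetric
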